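{- Let $G=(S,A_1,A_2,\to,\mathit{Goal})$ be a GLTS, let $s\in S$ be a winning state for player $1$ in $G$, and let $\sigma$ be a winning strategy at $s$ in $G$. Then: (1) there exists $n\in\mathbb{N}$ that is the depth of $\sigma$ at $s$ in $G$; and (2) if $s\notin \mathit{Goal}$, then for every $a\in \mathit{Next}_\sigma(s)$ with $s\xrightarrow{a}s'$, the depth of $\sigma$ at $s'$ in $G$ is some $m$ with $0\le m<n$.
   Context: A (deterministic) game labelled transition system (GLTS) is a tuple $G=(S,A_1,A_2,\to,\mathit{Goal})$ where $S$ is a set of states, $A_1$ (player 1 / controller actions) and $A_2$ (player 2 / environment actions) are finite sets with $A_1\cap A_2=\emptyset$, $A=A_1\cup A_2$, $\to\subseteq S\times A\times S$ is a transition relation that is deterministic (if $(s,a,s')\in\to$ and $(s,a,s'')\in\to$ then $s'=s''$), and $\mathit{Goal}\subseteq S$ is a set of goal states. Write $s\xrightarrow{a}s'$ for $(s,a,s')\in\to$; for $w=a_1\cdots a_n\in A^*$, $s\xrightarrow{w}s'$ means $s\xrightarrow{a_1}s_1\xrightarrow{a_2}\cdots\xrightarrow{a_n}s'$. Let $en_i(s)=\{a\in A_i\mid \exists s'.\,s\xrightarrow{a}s'\}$ for $i\in\{1,2\}$ and $en(s)=en_1(s)\cup en_2(s)$. A run from $s$ is a finite or infinite sequence of states $\pi=\pi_0\pi_1\cdots$ with $\pi_0=s$ and $\pi_{i-1}\xrightarrow{a_i}\pi_i$ for some actions $a_i$; its length $\ell(\pi)$ is the number of steps ($\infty$ if infinite).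 A run is maximal if it is infinite or $en(\pi_{\ell(\pi)})=\emptyset$. A strategy is a function $\sigma:S\to A_1\cup\{\bot\}$ such that $\sigma(s)\in en_1(s)$ if $en_1(s)\neq\emptyset$ and $\sigma(s)=\bot$ otherwise. Let $\mathit{Next}_\sigma(s)=en_2(s)\cup\{\sigma(s)\}$ if $\sigma(s)\neq\bot$ and $\mathit{Next}_\sigma(s)=en_2(s)$ otherwise. $\Pi^{max}_\sigma(s)$ is the set of maximal runs $\pi$ from $s$ such that for every $1\le i\le \ell(\pi)$ there is $a\in\mathit{Next}_\sigma(\pi_{i-1})$ with $\pi_{i-1}\xrightarrow{a}\pi_i$. $\sigma$ is a winning strategy (for player 1) at $s$ if every $\pi\in\Pi^{max}_\sigma(s)$ has a position $i$ with $\pi_i\in\mathit{Goal}$; $s$ is winning if such a $\sigma$ exists. If $\sigma$ is winning at $s$, then $n\in\mathbb{N}_0$ is the depth of $\sigma$ at $s$ if every $\pi\in\Pi^{max}_\sigma(s)$ has some $0\le i\le n$ with $\pi_i\in\mathit{Goal}$, and some $\pi'\in\Pi^{max}_\sigma(s)$ has $\pi'_n\in\mathit{Goal}$ and $\pi'_j\notin\mathit{Goal}$ for all $0\le j<n$. -}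

module Defs where

open import Data.Nat using (ℕ; zero; suc; _≤_; _<_)
open import Data.Fin using (Fin)
open import Data.Maybe using (Maybe; just; nothing)
open import Data.Sum using (_⊎_; inj₁; inj₂)
open import Data.Product using (Σ; ∃; _×_; _,_)
open import Data.Unit using (⊤)
open import Data.Empty using (⊥)
open import Relation.Nullary using (¬_)
open import Relation.Binary.PropositionalEquality using (_≡_)
open import Function.Bundles using (_↔_)

-- Player-1 actions A₁ and player-2 actions A₂ are finite types; the full action
-- set A = A₁ ⊎ A₂ is their disjoint union (so A₁ ∩ A₂ = ∅ holds by construction).
record GLTS : Set₁ where
  field
    S       : Set
    A₁      : Set
    A₂      : Set
    finite₁ : Σ ℕ λ k → A₁ ↔ Fin k
    finite₂ : Σ ℕ λ k → A₂ ↔ Fin k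
    _—[_]→_ : S → (A₁ ⊎ A₂) → S → Set
    determ  : ∀ {s a s′ s″} → s —[ a ]→ s′ → s —[ a ]→ s″ → s′ ≡ s″
    Goal    : S → Set

  A : Set
  A = A₁ ⊎ A₂

  En₁ : S → A₁ → Set
  En₁ s a = ∃ λ s′ → s —[ inj₁ a ]→ s′

  En₂ : S → A₂ → Set
  En₂ s b = ∃ λ s′ → s —[ inj₂ b ]→ s′

  En : S → A → Set
  En s a = ∃ λ s′ → s —[ a ]→ s′

open GLTS public

-- Strategy σ : S → A₁ ∪ {⊥}, with ⊥ rendered as nothing.
record Strategy (G : GLTS) : Set where
  field
    σ       : S G → Maybe (A₁ G)
    σ-en    : ∀ s a → σ s ≡ just a → En₁ G s a
    σ-none  : ∀ s → σ s ≡ nothing → ∀ a → ¬ En₁ G s a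

open Strategy public

Next : (G : GLTS) → Strategy G → S G → A G → Set
Next G str s (inj₁ a) = σ str s ≡ just a
Next G str s (inj₂ b) = En₂ G s b

-- Lengths of runs: just n for finite length n, nothing for ∞.
-- i ≤ℓ l  means  i ≤ l  (always true for l = ∞).
_≤ℓ_ : ℕ → Maybe ℕ → Set
i ≤ℓ just n  = i ≤ n
i ≤ℓ nothing = ⊤

MaximalEnd : (G : GLTS) → (ℕ → S G) → Maybe ℕ → Set
MaximalEnd G st nothing  = ⊤
MaximalEnd G st (just n) = ∀ a → ¬ En G (st n) a

-- The run is π_i = st i for i ≤ len
-- (values of st beyond the length are irrelevant).
record MaxRun (G : GLTS) (str : Strategy G) (s : S G) : Set where
  field
    len     : Maybe ℕ
    st      : ℕ → S G
    start   : st 0 ≡ s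
    steps   : ∀ i → suc i ≤ℓ len →
              Σ (A G) λ a → Next G str (st i) a × (G —[ st i ]→ a) (st (suc i))
    maximal : MaximalEnd G st len

open MaxRun public

Winning : (G : GLTS) → Strategy G → S G → Set
Winning G str s = (π : MaxRun G str s) →
  ∃ λ i → i ≤ℓ len π × Goal G (st π i)

WinningState : (G : GLTS) → S G → Set
WinningState G s = Σ (Strategy G) λ str → Winning G str s

-- n is the depth of σ at s (the winning requirement is stated separately)
IsDepth : (G : GLTS) → Strategy G → S G → ℕ → Set
IsDepth G str s n =
  ((π : MaxRun G str s) → ∃ λ i → i ≤ n × i ≤ℓ len π × Goal G (st π i))
  × (Σ (MaxRun G str s) λ π′ → n ≤ℓ len π′ × Goal G (st π′ n)
       × (∀ j → j < n → ¬ Goal G (st π′ j)))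

module Submission where

-- Call a state x  n-bounded  if every maximal
-- σ-run from x meets Goal within its first n steps.  The proof rests on three
-- facts about this notion.
--   * Bounds shift along moves: if x ∉ Goal is (n+1)-bounded and x → y is a
--     σ-move, then y is n-bounded (prepend the move to any run from y).
--   * König's lemma: a σ-winning state is n-bounded for some n.  Otherwise,
--     since the action sets are finite and G is deterministic, an unbounded
--     winning state has an unbounded winning σ-successor; following such
--     successors forever gives an infinite σ-run that never meets Goal.
--   * The least n for which x is n-bounded is the depth of σ at x: a run that
--     avoids Goal before step n must meet it exactly at step n.
-- Part (1) of the theorem is König's lemma plus the last fact; part (2) shifts
-- the bound n of s to every successor s′, whose depth is then at most n - 1.
-- Excluded middle is used to pick least elements, to build maximal runs and
-- to turn "not bounded" into a witnessing run.

open import Defs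
open import Level using (0ℓ)
open import Axiom.ExcludedMiddle using (ExcludedMiddle)
open import Axiom.DoubleNegationElimination using (em⇒dne)
open import Data.Nat using (ℕ; zero; suc; _≤_; _<_; z≤n; s≤s; _⊔_; pred)
open import Data.Nat.Properties
  using (≤-refl; ≤-trans; <⇒≤; ≤-pred; m≤m⊔n; m≤n⊔m; m≤n⇒m<n∨m≡n)
open import Data.Nat.Induction using (<-wellFounded)
open import Induction.WellFounded using (Acc; acc)
open import Data.Fin using (Fin)
open import Data.Maybe using (just; nothing; map)
open import Data.Product using (Σ; ∃; _×_; _,_; proj₁; proj₂)
open import Data.Sum using (_⊎_; inj₁; inj₂)
open import Data.Unit using (tt)
open import Data.Empty using (⊥-elim)
open import Function.Bundles using (_↔_; Inverse)
open import Relation.Nullary using (¬_; yes; no)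
open import Relation.Nullary.Negation using (¬∃⟶∀¬)
open import Relation.Binary.PropositionalEquality using (_≡_; refl; sym; subst)

least : ExcludedMiddle 0ℓ → (P : ℕ → Set) → ∀ {n} → P n →
        Σ ℕ λ m → m ≤ n × P m × (∀ k → k < m → ¬ P k)
least em P {n} = descend n (<-wellFounded n)
  where
    descend : ∀ n → Acc _<_ n → P n → Σ ℕ λ m → m ≤ n × P m × (∀ k → k < m → ¬ P k)
    descend n (acc smaller) pₙ with em {Σ ℕ λ k → k < n × P k}
    ... | no none = n , ≤-refl , pₙ , λ k k<n pₖ → none (k , k<n , pₖ)
    ... | yes (k , k<n , pₖ) with descend k (smaller k<n) pₖ
    ...   | m , m≤k , pₘ , minimal = m , ≤-trans m≤k (<⇒≤ k<n) , pₘ , minimal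

¬∀⇒∃¬ : ExcludedMiddle 0ℓ → {T : Set} {P : T → Set} → ¬ (∀ t → P t) → ∃ λ t → ¬ P t
¬∀⇒∃¬ em notAll =
  em⇒dne em λ noCounterexample → notAll λ t → em⇒dne em (¬∃⟶∀¬ noCounterexample t)

boundFin : ∀ k (f : Fin k → ℕ) → Σ ℕ λ N → ∀ i → f i ≤ N
boundFin zero f = 0 , λ ()
boundFin (suc k) f with boundFin k (λ i → f (Fin.suc i))
... | N , bound = f Fin.zero ⊔ N , λ
  { Fin.zero → m≤m⊔n _ _
  ; (Fin.suc i) → ≤-trans (bound i) (m≤n⊔m _ _) }

boundFinite : {T : Set} → (Σ ℕ λ k → T ↔ Fin k) → (f : T → ℕ) → Σ ℕ λ N → ∀ t → f t ≤ N
boundFinite (k , T↔Fin) f with boundFin k (λ i → f (Inverse.from T↔Fin i))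
... | N , bound =
  N , λ t → subst (λ u → f u ≤ N) (Inverse.strictlyInverseʳ T↔Fin t) (bound (Inverse.to T↔Fin t))

≤ℓ-trans : ∀ {j n l} → j ≤ n → n ≤ℓ l → j ≤ℓ l
≤ℓ-trans {l = just _} j≤n n≤l = ≤-trans j≤n n≤l
≤ℓ-trans {l = nothing} _ _ = tt

0≤ℓ : ∀ l → 0 ≤ℓ l
0≤ℓ (just _) = z≤n
0≤ℓ nothing = tt

≤ℓ-suc : ∀ {j} l → suc j ≤ℓ map suc l → j ≤ℓ l
≤ℓ-suc (just _) h = ≤-pred h
≤ℓ-suc nothing _ = tt

≤ℓ-pred : ∀ {j} l → 1 ≤ℓ l → j ≤ℓ map pred l → suc j ≤ℓ l
≤ℓ-pred (just (suc _)) _ h = s≤s h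
≤ℓ-pred nothing _ _ = tt

emptyOrStep : ∀ l → l ≡ just 0 ⊎ 1 ≤ℓ l
emptyOrStep (just zero) = inj₁ refl
emptyOrStep (just (suc _)) = inj₂ (s≤s z≤n)
emptyOrStep nothing = inj₂ tt

module Runs (G : GLTS) (str : Strategy G) where

  Move : S G → S G → Set
  Move x y = Σ (A G) λ a → Next G str x a × (G —[ x ]→ a) y

  Stuck : S G → Set
  Stuck x = ∀ a → ¬ En G x a

  -- A state without σ-moves is stuck: σ plays whenever player 1 can.
  noMove⇒stuck : ∀ {x} → ¬ Σ (S G) (Move x) → Stuck x
  noMove⇒stuck noMove (inj₂ b) (y , t) = noMove (y , inj₂ b , (y , t) , t)
  noMove⇒stuck {x} noMove (inj₁ a) (y , t) with σ str x in chosen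
  ... | just a′ = noMove (proj₁ (σ-en str x a′ chosen) , inj₁ a′ , chosen , proj₂ (σ-en str x a′ chosen))
  ... | nothing = σ-none str x chosen a (y , t)

  consRun : ∀ {x y} → Move x y → MaxRun G str y → MaxRun G str x
  consRun {x} (a , next , t) π = record
    { len = map suc (len π) ; st = extended ; start = refl
    ; steps = steps′ ; maximal = maximal′ (len π) (maximal π) }
    where
      extended : ℕ → S G
      extended zero = x
      extended (suc i) = st π i
      steps′ : ∀ i → suc i ≤ℓ map suc (len π) → Move (extended i) (extended (suc i))
      steps′ zero _ = a , next , subst (G —[ x ]→ a) (sym (start π)) t
      steps′ (suc i) h = steps π i (≤ℓ-suc (len π) h)
      maximal′ : ∀ l → MaximalEnd G (st π) l → MaximalEnd G extended (map suc l)
      maximal′ (just _) end = end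
      maximal′ nothing _ = tt

  tailRun : ∀ {x} (π : MaxRun G str x) → 1 ≤ℓ len π → MaxRun G str (st π 1)
  tailRun π 1≤l = record
    { len = map pred (len π) ; st = λ i → st π (suc i) ; start = refl
    ; steps = λ i h → steps π (suc i) (≤ℓ-pred (len π) 1≤l h)
    ; maximal = maximal′ (len π) 1≤l (maximal π) }
    where
      maximal′ : ∀ l → 1 ≤ℓ l → MaximalEnd G (st π) l → MaximalEnd G (λ i → st π (suc i)) (map pred l)
      maximal′ (just (suc _)) _ end = end
      maximal′ nothing _ _ = tt

  infiniteRun : (P : S G → Set) → (∀ {x} → P x → Σ (S G) λ y → Move x y × P y) →
                ∀ {x} → P x → Σ (MaxRun G str x) λ π → ∀ i → P (st π i)
  infiniteRun P continue {x} pₓ = run , λ i → proj₂ (path i)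
    where
      forgetMove : ∀ {y} → Σ (S G) (λ z → Move y z × P z) → Σ (S G) P
      forgetMove (z , _ , p) = z , p
      path : ℕ → Σ (S G) P
      path zero = x , pₓ
      path (suc i) = forgetMove (continue (proj₂ (path i)))
      run : MaxRun G str x
      run = record
        { len = nothing ; st = λ i → proj₁ (path i) ; start = refl
        ; steps = λ i _ → proj₁ (proj₂ (continue (proj₂ (path i)))) ; maximal = tt }

  Win : S G → Set
  Win = Winning G str

  Bounded : ℕ → S G → Set
  Bounded n x = (π : MaxRun G str x) → ∃ λ i → i ≤ n × i ≤ℓ len π × Goal G (st π i)

  Unbounded : S G → Set
  Unbounded x = ∀ n → ¬ Bounded n x

  Bounded-mono : ∀ {n m x} → n ≤ m → Bounded n x → Bounded m x
  Bounded-mono n≤m bounded π with bounded π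
  ... | i , i≤n , inRun , goal = i , ≤-trans i≤n n≤m , inRun , goal

  goal⇒bounded : ∀ {x} → Goal G x → Bounded 0 x
  goal⇒bounded goal π = 0 , z≤n , 0≤ℓ (len π) , subst (Goal G) (sym (start π)) goal

  unbounded⇒¬goal : ∀ {x} → Unbounded x → ¬ Goal G x
  unbounded⇒¬goal unbounded goal = unbounded 0 (goal⇒bounded goal)

  -- Winning and bounds pass to σ-successors of non-goal states, the bound
  -- dropping by one: runs from y extend to runs from x by one step.
  Win-step : ∀ {x y} → Win x → ¬ Goal G x → Move x y → Win y
  Win-step win notGoal move π with win (consRun move π)
  ... | zero , _ , goal = ⊥-elim (notGoal goal)
  ... | suc j , inRun , goal = j , ≤ℓ-suc (len π) inRun , goal

  Bounded-step : ∀ {n x y} → Bounded (suc n) x → ¬ Goal G x → Move x y → Bounded n y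
  Bounded-step bounded notGoal move π with bounded (consRun move π)
  ... | zero , _ , _ , goal = ⊥-elim (notGoal goal)
  ... | suc j , j<n , inRun , goal = j , ≤-pred j<n , ≤ℓ-suc (len π) inRun , goal

  -- A winning state whose σ-successors are all N-bounded is (N+1)-bounded
  -- (a run of length 0 from it must already be in Goal).
  successorsBounded⇒bounded : ∀ {N x} → Win x → (∀ {y} → Move x y → Bounded N y) → Bounded (suc N) x
  successorsBounded⇒bounded {N} {x} win boundedSucc π with emptyOrStep (len π)
  ... | inj₁ empty with win π
  ...   | i , inRun , goal = i , ≤-trans (subst (i ≤ℓ_) empty inRun) z≤n , inRun , goal
  successorsBounded⇒bounded {N} {x} win boundedSucc π | inj₂ 1≤l
    with boundedSucc (subst (λ z → Move z (st π 1)) (start π) (steps π 0 1≤l)) (tailRun π 1≤l)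
  ... | i , i≤N , inRun , goal = suc i , s≤s i≤N , ≤ℓ-pred (len π) 1≤l inRun , goal

module Classical (em : ExcludedMiddle 0ℓ) (G : GLTS) (str : Strategy G) where
  open Runs G str

  -- Every state has a maximal σ-run: keep taking some σ-move until stuck,
  -- and end the run at the first stuck state if there is one.
  module Walk (x : S G) where
    moveOrStuck : ∀ y → Σ (S G) (Move y) ⊎ Stuck y
    moveOrStuck y with em {Σ (S G) (Move y)}
    ... | yes move = inj₁ move
    ... | no noMove = inj₂ (noMove⇒stuck noMove)

    advance : ∀ y → Σ (S G) (Move y) ⊎ Stuck y → S G
    advance y (inj₁ (z , _)) = z
    advance y (inj₂ _) = y

    walk : ℕ → S G
    walk zero = x
    walk (suc i) = advance (walk i) (moveOrStuck (walk i))

    walkMove : ∀ i → ¬ Stuck (walk i) → Move (walk i) (walk (suc i))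
    walkMove i notStuck with moveOrStuck (walk i)
    ... | inj₁ (_ , move) = move
    ... | inj₂ stuck = ⊥-elim (notStuck stuck)

    run : MaxRun G str x
    run with em {Σ ℕ λ n → Stuck (walk n)}
    ... | no neverStuck = record
      { len = nothing ; st = walk ; start = refl
      ; steps = λ i _ → walkMove i (λ stuck → neverStuck (i , stuck)) ; maximal = tt }
    ... | yes (n , stuck) with least em (λ n → Stuck (walk n)) {n} stuck
    ...   | m , _ , stuckₘ , notBefore = record
      { len = just m ; st = walk ; start = refl
      ; steps = λ i i<m → walkMove i (notBefore i i<m) ; maximal = stuckₘ }

  anyRun : ∀ x → MaxRun G str x
  anyRun = Walk.run

  ¬unbounded⇒bounded : ∀ {x} → ¬ Unbounded x → ∃ λ n → Bounded n x
  ¬unbounded⇒bounded notUnbounded = em⇒dne em λ noBound → notUnbounded (¬∃⟶∀¬ noBound)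

  -- Finitely many actions and determinism: if every σ-successor is bounded,
  -- one bound serves for all of them.
  uniformSuccessorBound : ∀ {x} → (∀ {y} → Move x y → ∃ λ n → Bounded n y) →
                          ∃ λ N → ∀ {y} → Move x y → Bounded N y
  uniformSuccessorBound {x} boundedSucc = N , λ { (a , next , t) → Bounded-mono (≤N a) (bound a next t) }
    where
      actionBound : ∀ a → Σ ℕ λ n → ∀ {y} → Next G str x a → (G —[ x ]→ a) y → Bounded n y
      actionBound a with em {Σ (S G) λ y → Next G str x a × (G —[ x ]→ a) y}
      ... | no none = 0 , λ next t → ⊥-elim (none (_ , next , t))
      ... | yes (y , next , t) with boundedSucc (a , next , t)
      ...   | n , bounded = n , λ _ t′ → subst (Bounded n) (determ G t t′) bounded
      bound : ∀ a {y} → Next G str x a → (G —[ x ]→ a) y → Bounded (proj₁ (actionBound a)) y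
      bound a = proj₂ (actionBound a)
      N₁ = boundFinite (finite₁ G) (λ a → proj₁ (actionBound (inj₁ a)))
      N₂ = boundFinite (finite₂ G) (λ b → proj₁ (actionBound (inj₂ b)))
      N : ℕ
      N = proj₁ N₁ ⊔ proj₁ N₂
      ≤N : ∀ a → proj₁ (actionBound a) ≤ N
      ≤N (inj₁ a) = ≤-trans (proj₂ N₁ a) (m≤m⊔n _ _)
      ≤N (inj₂ b) = ≤-trans (proj₂ N₂ b) (m≤n⊔m _ _)

  unboundedSuccessor : ∀ {x} → Win x × Unbounded x → Σ (S G) λ y → Move x y × (Win y × Unbounded y)
  unboundedSuccessor {x} (win , unbounded) with em {Σ (S G) λ y → Move x y × Unbounded y}
  ... | yes (y , move , unboundedʸ) =
    y , move , Win-step win (unbounded⇒¬goal unbounded) move , unboundedʸ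
  ... | no none with uniformSuccessorBound (λ move → ¬unbounded⇒bounded λ u → none (_ , move , u))
  ...   | N , boundedSucc = ⊥-elim (unbounded (suc N) (successorsBounded⇒bounded win boundedSucc))

  winning⇒bounded : ∀ {x} → Win x → ∃ λ n → Bounded n x
  winning⇒bounded {x} win = ¬unbounded⇒bounded λ unbounded →
    let (π , invariant) = infiniteRun (λ y → Win y × Unbounded y) unboundedSuccessor (win , unbounded)
        (i , _ , goal) = win π
    in unbounded⇒¬goal (proj₂ (invariant i)) goal

  avoidingRun : ∀ {n x} → (∀ k → k < n → ¬ Bounded k x) →
                Σ (MaxRun G str x) λ π → ∀ i → i < n → i ≤ℓ len π → ¬ Goal G (st π i)
  avoidingRun {zero} {x} _ = anyRun x , λ _ ()
  avoidingRun {suc k} notBounded with ¬∀⇒∃¬ em (notBounded k ≤-refl)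
  ... | π , noGoal = π , λ i i<n inRun goal → noGoal (i , ≤-pred i<n , inRun , goal)

  leastBound⇒depth : ∀ {n x} → Bounded n x → (∀ k → k < n → ¬ Bounded k x) → IsDepth G str x n
  leastBound⇒depth {n} bounded notBounded with avoidingRun notBounded
  ... | π , noGoal with bounded π
  ...   | i , i≤n , inRun , goal with m≤n⇒m<n∨m≡n i≤n
  ...     | inj₁ i<n = ⊥-elim (noGoal i i<n inRun goal)
  ...     | inj₂ refl = bounded , π , inRun , goal ,
                        λ j j<n → noGoal j j<n (≤ℓ-trans (<⇒≤ j<n) inRun)

  depthBelow : ∀ {n x} → Bounded n x → Σ ℕ λ m → m ≤ n × IsDepth G str x m
  depthBelow {x = x} bounded with least em (λ n → Bounded n x) bounded
  ... | m , m≤n , boundedₘ , minimal = m , m≤n , leastBound⇒depth boundedₘ minimal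

  depth-step : ∀ {n x y} → IsDepth G str x n → ¬ Goal G x → Move x y →
               Σ ℕ λ m → m < n × IsDepth G str y m
  depth-step {zero} (_ , π , _ , goal , _) notGoal _ = ⊥-elim (notGoal (subst (Goal G) (start π) goal))
  depth-step {suc n} (bounded , _) notGoal move with depthBelow (Bounded-step bounded notGoal move)
  ... | m , m≤n , depth = m , s≤s m≤n , depth

lemma2p7 : ExcludedMiddle 0ℓ →
    (G : GLTS) (s : S G) → WinningState G s →
    (str : Strategy G) → Winning G str s →
    Σ ℕ λ n → IsDepth G str s n
      × (¬ Goal G s → ∀ a s′ → Next G str s a → (G —[ s ]→ a) s′ →
           Σ ℕ λ m → m < n × IsDepth G str s′ m)
lemma2p7 em G s _ str win =
  let (n , bounded) = winning⇒bounded win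
      (d , _ , depth) = depthBelow bounded
  in d , depth , λ notGoal a s′ next t → depth-step depth notGoal (a , next , t)
  where open Classical em G str
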